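{- Let $A$ be a setoid, $B$ a setoid family over $A$ and $(C,a_C)$ a $P_B$-algebra. For every $(F,R)$ in $\mathsf{RFam}$, \[\mathsf{cmprh}\,F\approx(P_B\,(a_C\circ(\mathsf{cmprh}\,F)))\circ\mathsf{us}.\] Hence $a_C\circ(\mathsf{cmprh}\,F):W\Rightarrow C$ is an algebra morphism, i.e. $(a_C\circ(\mathsf{cmprh}\,F))\circ\mathsf{s}\approx a_C\circ P_B(a_C\circ(\mathsf{cmprh}\,F))$.
   Context: Setting: intensional Martin-Löf type theory with $\Pi$-types and a universe $\mathsf{U}$ closed under $\Pi$ and containing intensional $\Sigma$-types, identity types, the unit type, W-types and dependent W-types (inductive families); logic is propositions-as-types. A setoid $X$ is a tuple $(X_0,\approx_X,r_X,s_X,t_X)$ with $X_0:\mathsf{U}$, $\approx_X:X_0\to X_0\to\mathsf{U}$ and witnesses of reflexivity, symmetry, transitivity; $x:X$ means $x:X_0$. An extensional function $f:X\Rightarrow Y$ is $f_0:X_0\to Y_0$ with a proof of $\prod_{x,x'}x\approx x'\to f_0x\approx f_0x'$; the setoid $X\Rightarrow Y$ has $f\approx g:=\prod_x f_0x\approx g_0x$. A setoid family $B$ over a setoid $A$ gives a setoid $B\,a$ (underlying type $B_0a$) for $a:A$ and extensional transports $B_\alpha:B\,a\Rightarrow B\,a'$ for $\alpha:a\approx_Aa'$, functorial up to $\approx$, with $B_\alpha\approx B_{\alpha'}$ for all $\alpha,\alpha':a\approx a'$. Write $b\approx_\alpha b'$ for $B_\alpha b\approx b'$. $P_BX$ is the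 setoid on $\sum_{a:A_0}(B\,a\Rightarrow X)$ with $(a,k)\approx(a',k'):=\sum_{\alpha:a\approx a'}k\approx k'\circ B_\alpha$, and $P_Bf(a,k):=(a,f\circ k)$. A $P_B$-algebra is a setoid $C$ with extensional $a_C:P_BC\Rightarrow C$. $\mathrm{W}$ is the W-type on $A_0,B_0$ with constructor $\mathsf{sup}$, and $\mathsf{n}(\mathsf{sup}\,a\,f)\equiv a$, $\mathsf{b}(\mathsf{sup}\,a\,f)\equiv f$. $\mathcal{W}_B$ is the inductive family on $\mathrm{W}\times\mathrm{W}$ with single constructor $\mathsf{dsup}\,(w,w')\,\alpha\,\phi:\mathcal{W}_B\,w\,w'$ for $\alpha:\mathsf{n}w\approx_A\mathsf{n}w'$ and $\phi:\prod_{(b,b',\beta):\sum_{b,b'}b\approx_\alpha b'}\mathcal{W}_B(\mathsf{b}\,w\,b)(\mathsf{b}\,w'\,b')$. The setoid $W$ has underlying type $\sum_w\mathcal{W}_B\,w\,w$ and $(w,\_)\approx_W(w',\_):=\mathcal{W}_B\,w\,w'$. For $\gamma:w\approx_Ww'$, $\mathsf{n}\triangleright\gamma:\mathsf{n}w\approx_A\mathsf{n}w'$ is its label component; each $\mathsf{b}\,w:B(\mathsf{n}w)\Rightarrow W$ is extensional. $\mathsf{s}:P_BW\Rightarrow W$ sends $(a,f)$ to the tree $\mathsf{sup}\,a\,(\lambda b.\mathrm{pr}_1(f_0b))$ (with a proof that it lies in $W$), and $\mathsf{us}:W\Rightarrow P_BW$ is $w\mapsto(\mathsf{n}\,w,\mathsf{b}\,w)$.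 For $w:W$, $\mathsf{ImS}\,w$ is the setoid on $B_0(\mathsf{n}w)$ with $s\approx s':=\mathsf{b}\,w\,s\approx_W\mathsf{b}\,w\,s'$; for $\gamma:w\approx_Ww'$, $\mathsf{ImS}_\gamma:=B_{\mathsf{n}\triangleright\gamma}$. $e_w:B(\mathsf{n}w)\Rightarrow\mathsf{ImS}\,w$ is the identity on underlying types and $m_w:\mathsf{ImS}\,w\Rightarrow W$ has underlying function $\mathsf{b}\,w$. $\mathsf{CohMaps}\,w$ is the setoid of families $F:\prod_{s:\mathsf{ImS}\,w}\mathsf{ImS}(\mathsf{b}\,w\,s)\Rightarrow C$ such that $F\,s\approx(F\,s')\circ\mathsf{ImS}_\sigma$ for all $\sigma:\mathsf{b}\,w\,s\approx_W\mathsf{b}\,w\,s'$. For $F:\mathsf{CohMaps}\,w$, $\mathsf{recst}\,w\,F:\mathsf{ImS}\,w\Rightarrow C$ is $s\mapsto a_C(\mathsf{n}(\mathsf{b}\,w\,s),(F\,s)\circ e_{\mathsf{b}ws})$. For $k:\mathsf{ImS}\,w\Rightarrow C$, $\mathsf{RecDef}\,w\,k$ is the inductive family (dependent W-type indexed by $\sum_{w:W}(\mathsf{ImS}\,w\Rightarrow C)$) with the single constructor: from $F:\mathsf{CohMaps}\,w$, a proof of $k\approx\mathsf{recst}\,w\,F$ and $\prod_{s:B_0(\mathsf{n}w)}\mathsf{RecDef}\,(\mathsf{b}\,w\,s)\,(F\,s)$, form an element of $\mathsf{RecDef}\,w\,k$. $\mathsf{RFam}$ is the setoid of pairs $(F,R)$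 with $F:\prod_{w:W}\mathsf{ImS}\,w\Rightarrow C$ and $R:\prod_w\mathsf{RecDef}\,w\,(F\,w)$, with $(F,\_)\approx(F',\_):=\prod_wF\,w\approx F'\,w$. For $(F,R)$ in $\mathsf{RFam}$, $F$ is coherent ($F\,w\approx(F\,w')\circ\mathsf{ImS}_\gamma$ for all $\gamma:w\approx_Ww'$) and $\mathsf{cmprh}\,F:W\Rightarrow P_BC$ is the extensional function $w\mapsto(\mathsf{n}\,w,(F\,w)\circ e_w)$. -}

module Defs where

open import Level using (0ℓ)
open import Data.Product using (Σ; _,_; proj₁; proj₂; _×_)
open import Relation.Binary.Bundles using (Setoid)
open import Function.Bundles using (Func)
import Function.Relation.Binary.Setoid.Equality as FunEq

open Setoid using (Carrier)
open Func using (to; cong)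

_⇒ₛ_ : Setoid 0ℓ 0ℓ → Setoid 0ℓ 0ℓ → Setoid 0ℓ 0ℓ
X ⇒ₛ Y = FunEq._⇨_ X Y

infixr 9 _∘F_
_∘F_ : {X Y Z : Setoid 0ℓ 0ℓ} → Func Y Z → Func X Y → Func X Z
g ∘F f = record { to = λ x → to g (to f x) ; cong = λ p → cong g (cong f p) }

record SetoidFamily (A : Setoid 0ℓ 0ℓ) : Set₁ where
  open Setoid A using () renaming (_≈_ to _≈A_)
  field
    Fib   : Carrier A → Setoid 0ℓ 0ℓ
    tr    : {a a' : Carrier A} → a ≈A a' → Func (Fib a) (Fib a')
    tr-id   : {a : Carrier A} (α : a ≈A a) (b : Carrier (Fib a)) →
              Setoid._≈_ (Fib a) (to (tr α) b) b
    tr-comp : {a a' a'' : Carrier A} (α : a ≈A a') (β : a' ≈A a'') (γ : a ≈A a'')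
              (b : Carrier (Fib a)) →
              Setoid._≈_ (Fib a'') (to (tr β) (to (tr α) b)) (to (tr γ) b)
    tr-irr  : {a a' : Carrier A} (α α' : a ≈A a') (b : Carrier (Fib a)) →
              Setoid._≈_ (Fib a') (to (tr α) b) (to (tr α') b)

module _ {A : Setoid 0ℓ 0ℓ} (B : SetoidFamily A) where
  open SetoidFamily B
  open Setoid A using () renaming (_≈_ to _≈A_; refl to reflA; sym to symA; trans to transA)
  private
    B₀ : Carrier A → Set
    B₀ a = Carrier (Fib a)
    module F {a} = Setoid (Fib a)

  _≈[_]_ : {a a' : Carrier A} → B₀ a → a ≈A a' → B₀ a' → Set
  b ≈[ α ] b' = F._≈_ (to (tr α) b) b'

  P : Setoid 0ℓ 0ℓ → Setoid 0ℓ 0ℓ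
  P X = record
    { Carrier = Σ (Carrier A) (λ a → Func (Fib a) X)
    ; _≈_ = λ { (a , k) (a' , k') →
                  Σ (a ≈A a') (λ α → Setoid._≈_ (Fib a ⇒ₛ X) k (k' ∘F tr α)) }
    ; isEquivalence = record
      { refl = λ { {a , k} → reflA , λ b → cong k (F.sym (tr-id reflA b)) }
      ; sym = λ { {a , k} {a' , k'} (α , p) →
          symA α , λ b → X.trans (cong k' (F.sym (F.trans (tr-comp (symA α) α reflA b) (tr-id reflA b))))
                                 (X.sym (p (to (tr (symA α)) b))) }
      ; trans = λ { {a , k} {a' , k'} {a'' , k''} (α , p) (β , q) →
          transA α β , λ b → X.trans (p b) (X.trans (q (to (tr α) b))
                                   (cong k'' (tr-comp α β (transA α β) b))) }
      }
    }
    where module X = Setoid X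

  Pmap : {X Y : Setoid 0ℓ 0ℓ} → Func X Y → Func (P X) (P Y)
  Pmap f = record
    { to = λ { (a , k) → a , (f ∘F k) }
    ; cong = λ { (α , p) → α , λ b → cong f (p b) } }

  data W₀ : Set where
    sup : (a : Carrier A) → (B₀ a → W₀) → W₀

  n : W₀ → Carrier A
  n (sup a f) = a

  br : (w : W₀) → B₀ (n w) → W₀
  br (sup a f) = f

  data 𝒲 : W₀ → W₀ → Set where
    dsup : {w w' : W₀} (α : n w ≈A n w') →
           ((b : B₀ (n w)) (b' : B₀ (n w')) → b ≈[ α ] b' → 𝒲 (br w b) (br w' b')) →
           𝒲 w w'

  n▷ : {w w' : W₀} → 𝒲 w w' → n w ≈A n w'
  n▷ (dsup α φ) = α

  𝒲-sym : {w w' : W₀} → 𝒲 w w' → 𝒲 w' w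
  𝒲-sym {w} {w'} (dsup α φ) = dsup (symA α) λ b' b β →
    𝒲-sym (φ b b' (F.trans (F.sym (cong (tr α) β))
                   (F.trans (tr-comp (symA α) α reflA b') (tr-id reflA b'))))

  𝒲-trans : {w w' w'' : W₀} → 𝒲 w w' → 𝒲 w' w'' → 𝒲 w w''
  𝒲-trans (dsup α φ) (dsup β ψ) = dsup (transA α β) λ b b'' γ →
    𝒲-trans (φ b (to (tr α) b) F.refl)
            (ψ (to (tr α) b) b'' (F.trans (tr-comp α β (transA α β) b) γ))

  W : Setoid 0ℓ 0ℓ
  W = record
    { Carrier = Σ W₀ (λ w → 𝒲 w w)
    ; _≈_ = λ x x' → 𝒲 (proj₁ x) (proj₁ x')
    ; isEquivalence = record
      { refl = λ { {w , r} → r }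
      ; sym = 𝒲-sym
      ; trans = 𝒲-trans } }

  private
    module WS = Setoid W

  nW : Carrier W → Carrier A
  nW x = n (proj₁ x)

  bW : (x : Carrier W) → Func (Fib (nW x)) W
  bW (sup a f , dsup α φ) = record
    { to = λ b → f b , φ b b (tr-id α b)
    ; cong = λ {b} {b'} p → φ b b' (F.trans (tr-id α b) p) }

  sW : Func (P W) W
  sW = record
    { to = λ { (a , f) → sup a (λ b → proj₁ (to f b)) ,
                 dsup reflA (λ b b' β → cong f (F.trans (F.sym (tr-id reflA b)) β)) }
    ; cong = λ { {a , f} {a' , f'} (α , p) →
                 dsup α (λ b b' β → WS.trans {to f b} {to f' (to (tr α) b)} {to f' b'} (p b) (cong f' β)) } }

  us : Func W (P W)
  us = record
    { to = λ x → nW x , bW x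
    ; cong = λ { {sup a f , dsup α φ} {sup a' f' , dsup α' φ'} (dsup γ ψ) →
                 γ , λ b → ψ b (to (tr γ) b) F.refl } }

  ImS : Carrier W → Setoid 0ℓ 0ℓ
  ImS x = record
    { Carrier = B₀ (nW x)
    ; _≈_ = λ s s' → to (bW x) s WS.≈ to (bW x) s'
    ; isEquivalence = record
      { refl = λ {s} → WS.refl {to (bW x) s}
      ; sym = λ {s} {s'} → WS.sym {to (bW x) s} {to (bW x) s'}
      ; trans = λ {s} {s'} {s''} → WS.trans {to (bW x) s} {to (bW x) s'} {to (bW x) s''} } }

  ImS-tr-cong : {x x' : Carrier W} (γ : x WS.≈ x') {s s' : B₀ (nW x)} →
                to (bW x) s WS.≈ to (bW x) s' →
                to (bW x') (to (tr (n▷ γ)) s) WS.≈ to (bW x') (to (tr (n▷ γ)) s')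
  ImS-tr-cong {sup a f , dsup α φ} {sup a' f' , dsup α' φ'} (dsup γ ψ) {s} {s'} p =
    WS.trans {bx' (to (tr γ) s)} {bx s} {bx' (to (tr γ) s')}
             (WS.sym {bx s} {bx' (to (tr γ) s)} (ψ s (to (tr γ) s) F.refl))
             (WS.trans {bx s} {bx s'} {bx' (to (tr γ) s')} p (ψ s' (to (tr γ) s') F.refl))
    where bx = to (bW (sup a f , dsup α φ))
          bx' = to (bW (sup a' f' , dsup α' φ'))

  ImS-tr : {x x' : Carrier W} → x WS.≈ x' → Func (ImS x) (ImS x')
  ImS-tr γ = record { to = to (tr (n▷ γ)) ; cong = ImS-tr-cong γ }

  e : (x : Carrier W) → Func (Fib (nW x)) (ImS x)
  e x = record { to = λ s → s ; cong = cong (bW x) }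

  m : (x : Carrier W) → Func (ImS x) W
  m x = record { to = to (bW x) ; cong = λ p → p }

  module _ (C : Setoid 0ℓ 0ℓ) (aC : Func (P C) C) where
    private module CS = Setoid C

    record CohMaps (x : Carrier W) : Set where
      field
        fam : (s : Carrier (ImS x)) → Func (ImS (to (bW x) s)) C
        coh : (s s' : Carrier (ImS x)) (σ : to (bW x) s WS.≈ to (bW x) s') →
              Setoid._≈_ (ImS (to (bW x) s) ⇒ₛ C) (fam s) (fam s' ∘F ImS-tr σ)
    open CohMaps public

    recst : (x : Carrier W) → CohMaps x → Func (ImS x) C
    recst x G = record
      { to = λ s → to aC (nW (to (bW x) s) , (fam G s ∘F e (to (bW x) s)))
      ; cong = λ {s} {s'} σ → cong aC (n▷ σ , coh G s s' σ) }

    data RecDef : (x : Carrier W) → Func (ImS x) C → Set where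
      recdef : {x : Carrier W} {k : Func (ImS x) C} (G : CohMaps x) →
               Setoid._≈_ (ImS x ⇒ₛ C) k (recst x G) →
               ((s : B₀ (nW x)) → RecDef (to (bW x) s) (fam G s)) →
               RecDef x k

    RFam : Set
    RFam = Σ ((x : Carrier W) → Func (ImS x) C) (λ F → (x : Carrier W) → RecDef x (F x))

    _≈RFam_ : RFam → RFam → Set
    (F , _) ≈RFam (F' , _) = (x : Carrier W) → Setoid._≈_ (ImS x ⇒ₛ C) (F x) (F' x)

    RecDef-coh : {x x' : Carrier W} (γ : x WS.≈ x') {k : Func (ImS x) C} {k' : Func (ImS x') C} →
                 RecDef x k → RecDef x' k' →
                 Setoid._≈_ (ImS x ⇒ₛ C) k (k' ∘F ImS-tr γ)
    RecDef-coh {sup a f , dsup α φ} {sup a' f' , dsup α' φ'} (dsup γ ψ)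
               (recdef G p R) (recdef G' p' R') t =
      CS.trans (p t) (CS.trans
        (cong aC (n▷ δ , λ u → RecDef-coh δ (R t) (R' (to (tr γ) t)) u))
        (CS.sym (p' (to (tr γ) t))))
      where δ = ψ t (to (tr γ) t) F.refl

    cmprh : RFam → Func W (P C)
    cmprh (F , R) = record
      { to = λ x → nW x , (F x ∘F e x)
      ; cong = λ {x} {x'} γ → n▷ γ , RecDef-coh γ (R x) (R x') }

module Submission where

-- Write h := a_C ∘ cmprh F.  The first claim says that the
-- component F w : ImS w ⇒ C of a recursive family agrees with h on the
-- immediate subtrees of w.  This holds because the RecDef witness at w
-- exhibits F w as  recst w G  for a coherent family G, and G s agrees
-- with F (b w s) by coherence of RecDef witnesses (RecDef-coh in Defs),
-- so  F w s ≈ a_C (n (b w s), F (b w s) ∘ e) = h (b w s).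
-- The second claim (h is an algebra morphism) is then purely formal:
-- us is a left inverse of s, so any map g with  g ≈ P_B h ∘ us  satisfies
-- a_C ∘ g ∘ s ≈ a_C ∘ P_B h ∘ us ∘ s ≈ a_C ∘ P_B h.

open import Defs
open import Level using (0ℓ)
open import Data.Product using (_×_; _,_; proj₁; proj₂)
open import Relation.Binary.Bundles using (Setoid)
open import Function.Bundles using (Func)
open Func using (to; cong)

module _ {A : Setoid 0ℓ 0ℓ} (B : SetoidFamily A) where
  open SetoidFamily B
  open Setoid A using () renaming (refl to reflA)

  us∘sW≈id : (y : Setoid.Carrier (P B (W B))) → Setoid._≈_ (P B (W B)) (to (us B ∘F sW B) y) y
  us∘sW≈id (a , f) = reflA , λ b → cong f (Setoid.sym (Fib a) (tr-id reflA b))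

  coalgebra-square⇒morphism :
    {C : Setoid 0ℓ 0ℓ} (aC : Func (P B C) C) (g : Func (W B) (P B C)) (h : Func (W B) C) →
    Setoid._≈_ (W B ⇒ₛ P B C) g (Pmap B h ∘F us B) →
    Setoid._≈_ (P B (W B) ⇒ₛ C) (aC ∘F g ∘F sW B) (aC ∘F Pmap B h)
  coalgebra-square⇒morphism {C} aC g h g≈Ph∘us y =
    Setoid.trans C (cong aC {to g tree} {to (Pmap B h) unfolded} (g≈Ph∘us tree))
                   (cong aC (cong (Pmap B h) {unfolded} {y} (us∘sW≈id y)))
    where
      tree : Setoid.Carrier (W B)
      tree = to (sW B) y
      unfolded : Setoid.Carrier (P B (W B))
      unfolded = to (us B) tree

  module _ (C : Setoid 0ℓ 0ℓ) (aC : Func (P B C) C) (FR : RFam B C aC) where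
    private
      module CS = Setoid C
      F : (x : Setoid.Carrier (W B)) → Func (ImS B x) C
      F = proj₁ FR
      R : (x : Setoid.Carrier (W B)) → RecDef B C aC x (F x)
      R = proj₂ FR

    rec : Func (W B) C
    rec = aC ∘F cmprh B C aC FR

    -- Each component F w is rec restricted to the immediate subtrees of w:
    -- unfold the RecDef witness at w, then identify the coherent family
    -- it contains with F on the subtrees via RecDef-coh (at reflexivity).
    RFam-unfold : (x : Setoid.Carrier (W B)) (s : Setoid.Carrier (ImS B x)) →
                  to (F x) s CS.≈ to rec (to (bW B x) s)
    RFam-unfold x s with R x
    ... | recdef G F≈recst R-sub =
      CS.trans (F≈recst s)
               (cong aC (n▷ B self , RecDef-coh B C aC self (R-sub s) (R (to (bW B x) s))))
      where
        self : Setoid._≈_ (W B) (to (bW B x) s) (to (bW B x) s)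
        self = Setoid.refl (W B) {to (bW B x) s}

    cmprh≈Prec∘us : Setoid._≈_ (W B ⇒ₛ P B C) (cmprh B C aC FR) (Pmap B rec ∘F us B)
    cmprh≈Prec∘us x = reflA , λ b →
      CS.trans (RFam-unfold x b)
               (cong (rec ∘F bW B x) (Setoid.sym (Fib (nW B x)) (tr-id reflA b)))

corollary3p16 : (A : Setoid 0ℓ 0ℓ) (B : SetoidFamily A) (C : Setoid 0ℓ 0ℓ)
    (aC : Func (P B C) C) (FR : RFam B C aC) →
    Setoid._≈_ (W B ⇒ₛ P B C) (cmprh B C aC FR)
    (Pmap B (aC ∘F cmprh B C aC FR) ∘F us B)
    × Setoid._≈_ (P B (W B) ⇒ₛ C) ((aC ∘F cmprh B C aC FR) ∘F sW B)
    (aC ∘F Pmap B (aC ∘F cmprh B C aC FR))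
corollary3p16 A B C aC FR =
  square , coalgebra-square⇒morphism B aC (cmprh B C aC FR) (rec B C aC FR) square
  where
    square : Setoid._≈_ (W B ⇒ₛ P B C) (cmprh B C aC FR) (Pmap B (rec B C aC FR) ∘F us B)
    square = cmprh≈Prec∘us B C aC FR
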